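{- Let $r\ge2$ and let $n_2,\dots,n_r$ be non-negative integers. 1) If $n_2\ge1$, then $M(0,n_2,\dots,n_r)\le M(1,n_2-1,n_3,\dots,n_r)$. 2) If $n_2\ge2$, then $M(0,n_2,\dots,n_r)<M(1,n_2-1,n_3,\dots,n_r)$. Let $1\le k\le r$. 3) If $n_2\ge1$, then $V_k(0,n_2,\dots,n_r)\le V_k(1,n_2-1,n_3,\dots,n_r)$. 4) If $n_2\ge2$ and $n_2+\dots+n_r\ge3$, then $V_k(0,n_2,\dots,n_r)<V_k(1,n_2-1,n_3,\dots,n_r)$.
   Context: For non-negative integers $n_1,\dots,n_s$ with $n=n_1+\dots+n_s\ge1$, define $$M(n_1,\dots,n_s)=\frac1n\sum_{d\mid\gcd(n_1,\dots,n_s)}\mu(d)\frac{(n/d)!}{(n_1/d)!\cdots(n_s/d)!},$$ where $\mu$ is the Möbius function (gcd ignoring zero entries); it counts aperiodic circular words of length $n$ with letter $x_i$ occurring exactly $n_i$ times. For $1\le k\le s$, with $t_k=n_1+\dots+n_k$, $$V_k(n_1,\dots,n_s)=\frac{(-1)^{t_k}}{n}\sum_{d\mid\gcd(n_1,\dots,n_s)}\mu(d)(-1)^{t_k/d}\frac{(n/d)!}{(n_1/d)!\cdots(n_s/d)!}.$$ -}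

module Defs where

open import Data.Nat as ℕ using (ℕ; zero; suc; _+_; _*_; NonZero)
open import Data.Nat.Properties using (_!≢0; m*n≢0)
open import Data.Nat.Combinatorics using ()
open import Data.Nat.Base using (_!)
open import Data.Nat.DivMod using (_/_)
open import Data.Nat.GCD using (gcd)
open import Data.Nat.Divisibility using (_∣_; _∣?_)
open import Data.Nat.Primality using (Prime; prime?)
open import Data.Integer as ℤ using (ℤ; +_; -[1+_])
open import Data.List using (List; []; _∷_; map; foldr; take; upTo; filter)
open import Data.Nat.ListAction using (sum)
open import Data.Bool using (if_then_else_)
open import Relation.Nullary.Decidable using (does; _×-dec_)
open import Data.Rational as ℚ using (ℚ)

-- gcd of a list (zero entries are ignored automatically since gcd 0 m = m)
gcdList : List ℕ → ℕ
gcdList = foldr gcd 0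

factProd : List ℕ → ℕ
factProd []       = 1
factProd (x ∷ xs) = x ! * factProd xs

factProd≢0 : ∀ xs → NonZero (factProd xs)
factProd≢0 []       = _
factProd≢0 (x ∷ xs) = m*n≢0 (x !) (factProd xs) {{x !≢0}} {{factProd≢0 xs}}

multinomial : List ℕ → ℕ
multinomial xs = (sum xs !) / factProd xs
  where instance _ = factProd≢0 xs

-- Möbius function: μ(n) = 0 if p² ∣ n for some prime p,
-- otherwise (-1)^(number of distinct primes dividing n).  (μ 0 = 0, unused.)
squareFree : ℕ → Data.Bool.Bool
squareFree n = foldr (λ p b → if does (prime? p ×-dec (p * p ∣? n)) then Data.Bool.false else b)
                     Data.Bool.true (upTo (suc n))

numPrimeDivisors : ℕ → ℕ
numPrimeDivisors n = Data.List.length (filter (λ p → prime? p ×-dec (p ∣? n)) (upTo (suc n)))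

negOnePow : ℕ → ℤ
negOnePow m = (ℤ.- ℤ.1ℤ) ℤ.^ m

μ : ℕ → ℤ
μ zero    = ℤ.0ℤ
μ n@(suc _) = if squareFree n then negOnePow (numPrimeDivisors n) else ℤ.0ℤ

divisors : ℕ → List ℕ
divisors g = filter (λ d → d ∣? g) (map suc (upTo g))

divAll : (d : ℕ) → .{{NonZero d}} → List ℕ → List ℕ
divAll d xs = map (λ x → x / d) xs

Msum : List ℕ → ℤ
Msum xs = foldr ℤ._+_ ℤ.0ℤ (map term (divisors (gcdList xs)))
  where
  term : ℕ → ℤ
  term zero    = ℤ.0ℤ
  term (suc e) = μ (suc e) ℤ.* (+ multinomial (divAll (suc e) xs))

-- M(n₁,…,nₛ) = (1/n) Σ …,  n = n₁+…+nₛ ; (value 0 if n = 0, never used)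
M : List ℕ → ℚ
M xs with sum xs
... | zero  = ℚ.0ℚ
... | suc m = Msum xs ℚ./ suc m

t : ℕ → List ℕ → ℕ
t k xs = sum (take k xs)

Vsum : ℕ → List ℕ → ℤ
Vsum k xs = foldr ℤ._+_ ℤ.0ℤ (map term (divisors (gcdList xs)))
  where
  term : ℕ → ℤ
  term zero    = ℤ.0ℤ
  term (suc e) = μ (suc e) ℤ.* negOnePow (t k xs / suc e) ℤ.* (+ multinomial (divAll (suc e) xs))

V : ℕ → List ℕ → ℚ
V k xs with sum xs
... | zero  = ℚ.0ℚ
... | suc m = (negOnePow (t k xs) ℤ.* Vsum k xs) ℚ./ suc m

{-# OPTIONS --safe #-}
module Submission where

-- Write W(xs) for the multinomial coefficient and τ(g) for the number of divisors of g.
-- For xs = (0, n₂, …) with g = gcd xs, the summand at a divisor d of g in n·M(xs) or n·V_k(xs)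
-- is bounded in absolute value by W(xs/d) ≤ W(xs): W only grows when every entry is multiplied
-- by d, by the inequality C(n,k)·C(m,l) ≤ C(n+m,k+l). Hence both are at most τ(g)·W(xs).
-- The tuple (1, n₂-1, …) has gcd 1, so n·M and n·V_k both equal its multinomial coefficient,
-- which is n₂·W(xs); and τ(g) ≤ g ≤ n₂ because g ∣ n₂.
-- For n₂ ≥ 2, τ(g) = n₂ forces g = n₂ = 2, so only d = 1, 2 contribute: for M, μ(2) = -1 gives
-- n·M(xs) ≤ W(xs) < 2·W(xs); for V_k, W(xs/2) < W(xs) once a later entry is non-zero.

open import Defs
open import Data.Nat using (ℕ; zero; suc; _+_; _*_; _∸_; _≤_; _<_; z≤n; s≤s; s≤s⁻¹; _!; NonZero; >-nonZero)
open import Data.Nat.Properties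
open import Data.Nat.Combinatorics using (_C_; nC1≡n; nCk+nC[k+1]≡[n+1]C[k+1]; k![n∸k]!∣n!)
open import Data.Nat.Combinatorics.Specification using (nCk≡n!/k![n-k]!)
open import Data.Nat.DivMod using (_/_; m/n*n≡m; m*n/n≡m; m*[n/m]≡n; n/1≡n; /-congˡ)
open import Data.Nat.Divisibility using (_∣_; _∣?_; ∣-trans; ∣-refl; ∣⇒≤; ∣1⇒≡1; ∣m+n∣m⇒∣n)
open import Data.Nat.GCD using (gcd[m,n]∣m; gcd[m,n]∣n; gcd-zeroˡ)
open import Data.Nat.ListAction using (sum)
open import Data.Nat.Tactic.RingSolver using (solve-∀)
open import Algebra.Properties.CommutativeSemigroup *-commutativeSemigroup using (x∙yz≈y∙xz)
open import Data.Integer as ℤ using (ℤ; +_; -[1+_]; ∣_∣; +≤+; +<+; 0ℤ; 1ℤ; -1ℤ)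
import Data.Integer.Properties as ℤ
open import Data.Rational as ℚ using ()
import Data.Rational.Properties as ℚ
import Data.Rational.Unnormalised as ℚᵘ
import Data.Rational.Unnormalised.Properties as ℚᵘ
open import Data.List using (List; []; _∷_; map; foldr; length; upTo)
open import Data.List.Properties using (map-cong; length-filter; filter-notAll; length-map; length-upTo)
open import Data.List.Membership.Propositional using (_∈_)
open import Data.List.Membership.Propositional.Properties using (∈-filter⁻; ∈-map⁺; ∈-upTo⁺)
open import Data.List.Relation.Unary.All as All using (All; []; _∷_)
open import Data.List.Relation.Unary.Any as Any using (here; there)
open import Data.Bool using (true; false)
open import Data.Product using (_×_; _,_; proj₂)
open import Data.Sum using (_⊎_; inj₁; inj₂)
open import Function using (_∘_)
open import Relation.Nullary using (¬_)
open import Relation.Binary.PropositionalEquality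

nCk≤[1+n]C[1+k] : ∀ n k → n C k ≤ suc n C suc k
nCk≤[1+n]C[1+k] n k = subst (n C k ≤_) (nCk+nC[k+1]≡[n+1]C[k+1] n k) (m≤m+n (n C k) (n C suc k))

nCk≤[1+n]Ck : ∀ n k → n C k ≤ suc n C k
nCk≤[1+n]Ck n zero    = ≤-refl
nCk≤[1+n]Ck n (suc k) = subst (n C suc k ≤_) (nCk+nC[k+1]≡[n+1]C[k+1] n k) (m≤n+m (n C suc k) (n C k))

[a+b]Ca>0 : ∀ a b → 1 ≤ (a + b) C a
[a+b]Ca>0 zero    b = ≤-refl
[a+b]Ca>0 (suc a) b = ≤-trans ([a+b]Ca>0 a b) (nCk≤[1+n]C[1+k] (a + b) a)

[a+b]Ca*a!*b!≡[a+b]! : ∀ a b → ((a + b) C a) * (a ! * b !) ≡ (a + b) !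
[a+b]Ca*a!*b!≡[a+b]! a b = begin
  ((a + b) C a) * (a ! * b !)               ≡⟨ cong (λ c → ((a + b) C a) * (a ! * c !)) (m+n∸m≡n a b) ⟨
  ((a + b) C a) * (a ! * (a + b ∸ a) !)     ≡⟨ cong (_* (a ! * (a + b ∸ a) !)) (nCk≡n!/k![n-k]! a≤a+b) ⟩
  ((a + b) ! / (a ! * (a + b ∸ a) !)) * _   ≡⟨ m/n*n≡m (k![n∸k]!∣n! a≤a+b) ⟩
  (a + b) !                                 ∎
  where
  open ≡-Reasoning
  a≤a+b = m≤m+n a b
  instance _ = a !* (a + b ∸ a) !≢0

binomialProduct : List ℕ → ℕ
binomialProduct []       = 1
binomialProduct (x ∷ xs) = ((x + sum xs) C x) * binomialProduct xs

sum!≡binomialProduct*factProd : ∀ xs → sum xs ! ≡ binomialProduct xs * factProd xs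
sum!≡binomialProduct*factProd []       = refl
sum!≡binomialProduct*factProd (x ∷ xs) = begin
  (x + s) !                                  ≡⟨ [a+b]Ca*a!*b!≡[a+b]! x s ⟨
  c * (x ! * s !)                            ≡⟨ cong (λ y → c * (x ! * y)) (sum!≡binomialProduct*factProd xs) ⟩
  c * (x ! * (binomialProduct xs * factProd xs)) ≡⟨ cong (c *_) (x∙yz≈y∙xz (x !) (binomialProduct xs) (factProd xs)) ⟩
  c * (binomialProduct xs * (x ! * factProd xs)) ≡⟨ *-assoc c (binomialProduct xs) _ ⟨
  c * binomialProduct xs * (x ! * factProd xs)   ∎
  where
  open ≡-Reasoning
  s = sum xs
  c = (x + s) C x

multinomial≡binomialProduct : ∀ xs → multinomial xs ≡ binomialProduct xs
multinomial≡binomialProduct xs = begin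
  sum xs ! / factProd xs                         ≡⟨ /-congˡ (sum!≡binomialProduct*factProd xs) ⟩
  binomialProduct xs * factProd xs / factProd xs ≡⟨ m*n/n≡m (binomialProduct xs) (factProd xs) ⟩
  binomialProduct xs                             ∎
  where
  open ≡-Reasoning
  instance _ = factProd≢0 xs

multinomial*factProd≡sum! : ∀ xs → multinomial xs * factProd xs ≡ sum xs !
multinomial*factProd≡sum! xs =
  trans (cong (_* factProd xs) (multinomial≡binomialProduct xs)) (sym (sum!≡binomialProduct*factProd xs))

binomialProduct>0 : ∀ xs → 1 ≤ binomialProduct xs
binomialProduct>0 []       = ≤-refl
binomialProduct>0 (x ∷ xs) = *-mono-≤ ([a+b]Ca>0 x (sum xs)) (binomialProduct>0 xs)

multinomial≢0 : ∀ xs → NonZero (multinomial xs)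
multinomial≢0 xs = >-nonZero (subst (1 ≤_) (sym (multinomial≡binomialProduct xs)) (binomialProduct>0 xs))

multinomial[1∷m∷xs]≡[1+m]*multinomial[0∷1+m∷xs] : ∀ m xs →
  multinomial (1 ∷ m ∷ xs) ≡ suc m * multinomial (0 ∷ suc m ∷ xs)
multinomial[1∷m∷xs]≡[1+m]*multinomial[0∷1+m∷xs] m xs = *-cancelʳ-≡ W₁ (suc m * W₀) (1 ! * (m ! * P)) (begin
  W₁ * (1 ! * (m ! * P))               ≡⟨ multinomial*factProd≡sum! (1 ∷ m ∷ xs) ⟩
  suc (m + sum xs) !                   ≡⟨ multinomial*factProd≡sum! (0 ∷ suc m ∷ xs) ⟨
  W₀ * (0 ! * (suc m ! * P))           ≡⟨ rearrange W₀ m (m !) P ⟩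
  suc m * W₀ * (1 ! * (m ! * P))       ∎)
  where
  open ≡-Reasoning
  W₀ = multinomial (0 ∷ suc m ∷ xs)
  W₁ = multinomial (1 ∷ m ∷ xs)
  P  = factProd xs
  instance _ = factProd≢0 (1 ∷ m ∷ xs)
  rearrange : ∀ w n f p → w * (1 * ((suc n * f) * p)) ≡ suc n * w * (1 * (f * p))
  rearrange = solve-∀

nCk*mCl≤[n+m]C[k+l] : ∀ n m k l → (n C k) * (m C l) ≤ (n + m) C (k + l)
nCk*mCl≤[n+m]C[k+l] zero    m zero    l = ≤-reflexive (+-identityʳ (m C l))
nCk*mCl≤[n+m]C[k+l] zero    m (suc k) l = z≤n
nCk*mCl≤[n+m]C[k+l] (suc n) m zero    l =
  ≤-trans (nCk*mCl≤[n+m]C[k+l] n m zero l) (nCk≤[1+n]Ck (n + m) l)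
nCk*mCl≤[n+m]C[k+l] (suc n) m (suc k) l = begin
  (suc n C suc k) * (m C l)                  ≡⟨ cong (_* (m C l)) (nCk+nC[k+1]≡[n+1]C[k+1] n k) ⟨
  (n C k + n C suc k) * (m C l)              ≡⟨ *-distribʳ-+ (m C l) (n C k) (n C suc k) ⟩
  (n C k) * (m C l) + (n C suc k) * (m C l)  ≤⟨ +-mono-≤ (nCk*mCl≤[n+m]C[k+l] n m k l) (nCk*mCl≤[n+m]C[k+l] n m (suc k) l) ⟩
  (n + m) C (k + l) + (n + m) C suc (k + l)  ≡⟨ nCk+nC[k+1]≡[n+1]C[k+1] (n + m) (k + l) ⟩
  suc (n + m) C suc (k + l)                  ∎
  where open ≤-Reasoning

[a+b]Ca≤[da+db]C[da] : ∀ d a b → .{{NonZero d}} → (a + b) C a ≤ (d * a + d * b) C (d * a)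
[a+b]Ca≤[da+db]C[da] (suc e) a b = begin
  (a + b) C a                                 ≤⟨ m≤m*n ((a + b) C a) _ {{>-nonZero ([a+b]Ca>0 (e * a) (e * b))}} ⟩
  ((a + b) C a) * ((e * a + e * b) C (e * a)) ≤⟨ nCk*mCl≤[n+m]C[k+l] (a + b) (e * a + e * b) a (e * a) ⟩
  ((a + b) + (e * a + e * b)) C (a + e * a)   ≡⟨ cong (_C (a + e * a)) (regroup a b e) ⟩
  (suc e * a + suc e * b) C (suc e * a)       ∎
  where
  open ≤-Reasoning
  regroup : ∀ a b e → (a + b) + (e * a + e * b) ≡ suc e * a + suc e * b
  regroup = solve-∀

sum-map-* : ∀ d xs → sum (map (d *_) xs) ≡ d * sum xs
sum-map-* d []       = sym (*-zeroʳ d)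
sum-map-* d (x ∷ xs) = trans (cong (_+_ (d * x)) (sum-map-* d xs)) (sym (*-distribˡ-+ d x (sum xs)))

binomialProduct≤binomialProduct[d*_] : ∀ d .{{_ : NonZero d}} xs → binomialProduct xs ≤ binomialProduct (map (d *_) xs)
binomialProduct≤binomialProduct[d*_] d []       = ≤-refl
binomialProduct≤binomialProduct[d*_] d (x ∷ xs) = *-mono-≤
  (subst (λ s → (x + sum xs) C x ≤ (d * x + s) C (d * x)) (sym (sum-map-* d xs)) ([a+b]Ca≤[da+db]C[da] d x (sum xs)))
  (binomialProduct≤binomialProduct[d*_] d xs)

map[d*]∘divAll≡id : ∀ d .{{_ : NonZero d}} {xs} → All (d ∣_) xs → map (d *_) (divAll d xs) ≡ xs
map[d*]∘divAll≡id d []         = refl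
map[d*]∘divAll≡id d (d∣x ∷ ds) = cong₂ _∷_ (m*[n/m]≡n d∣x) (map[d*]∘divAll≡id d ds)

divAll-1 : ∀ xs → divAll 1 xs ≡ xs
divAll-1 []       = refl
divAll-1 (x ∷ xs) = cong₂ _∷_ (n/1≡n x) (divAll-1 xs)

multinomial[divAll]≤multinomial : ∀ d .{{_ : NonZero d}} {xs} → All (d ∣_) xs →
  multinomial (divAll d xs) ≤ multinomial xs
multinomial[divAll]≤multinomial d {xs} ds = begin
  multinomial (divAll d xs)                   ≡⟨ multinomial≡binomialProduct (divAll d xs) ⟩
  binomialProduct (divAll d xs)               ≤⟨ binomialProduct≤binomialProduct[d*_] d (divAll d xs) ⟩
  binomialProduct (map (d *_) (divAll d xs))  ≡⟨ cong binomialProduct (map[d*]∘divAll≡id d ds) ⟩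
  binomialProduct xs                          ≡⟨ multinomial≡binomialProduct xs ⟨
  multinomial xs                              ∎
  where open ≤-Reasoning

[1+n]C1<[2+2n]C2 : ∀ n .{{_ : NonZero n}} → suc n C 1 < (2 + 2 * n) C 2
[1+n]C1<[2+2n]C2 n = begin-strict
  suc n C 1            ≡⟨ nC1≡n (suc n) ⟩
  suc n                <⟨ s≤s (subst (n <_) (*-comm n 2) (m<m*n n 2 ≤-refl)) ⟩
  suc (2 * n)          ≡⟨ nC1≡n (suc (2 * n)) ⟨
  suc (2 * n) C 1      ≤⟨ nCk≤[1+n]C[1+k] (suc (2 * n)) 1 ⟩
  (2 + 2 * n) C 2      ∎
  where open ≤-Reasoning

multinomial[divAll2]<multinomial : ∀ {xs} → All (2 ∣_) xs → 1 ≤ sum xs →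
  multinomial (divAll 2 (0 ∷ 2 ∷ xs)) < multinomial (0 ∷ 2 ∷ xs)
multinomial[divAll2]<multinomial {xs} ds 1≤sum = begin-strict
  multinomial (0 ∷ 1 ∷ ys)                        ≡⟨ multinomial≡binomialProduct (0 ∷ 1 ∷ ys) ⟩
  1 * ((suc S C 1) * B)                           ≡⟨ *-identityˡ _ ⟩
  (suc S C 1) * B                                 <⟨ *-monoˡ-< B {{B≢0}} ([1+n]C1<[2+2n]C2 S {{S≢0}}) ⟩
  ((2 + 2 * S) C 2) * B                           ≤⟨ *-monoʳ-≤ ((2 + 2 * S) C 2) (binomialProduct≤binomialProduct[d*_] 2 ys) ⟩
  ((2 + 2 * S) C 2) * B₂                          ≡⟨ cong (λ s → ((2 + s) C 2) * B₂) (sum-map-* 2 ys) ⟨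
  ((2 + sum (map (2 *_) ys)) C 2) * B₂            ≡⟨ *-identityˡ _ ⟨
  1 * (((2 + sum (map (2 *_) ys)) C 2) * B₂)      ≡⟨ multinomial≡binomialProduct (0 ∷ 2 ∷ map (2 *_) ys) ⟨
  multinomial (0 ∷ 2 ∷ map (2 *_) ys)             ≡⟨ cong (λ zs → multinomial (0 ∷ 2 ∷ zs)) (map[d*]∘divAll≡id 2 ds) ⟩
  multinomial (0 ∷ 2 ∷ xs)                        ∎
  where
  open ≤-Reasoning
  ys = divAll 2 xs
  S  = sum ys
  B  = binomialProduct ys
  B₂ = binomialProduct (map (2 *_) ys)
  B≢0 = >-nonZero (binomialProduct>0 ys)
  S≢0 : NonZero S
  S≢0 = m*n≢0⇒n≢0 2 {{>-nonZero (subst (1 ≤_) (trans (cong sum (sym (map[d*]∘divAll≡id 2 ds))) (sum-map-* 2 ys)) 1≤sum)}}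

gcdList-∣ : ∀ xs → All (gcdList xs ∣_) xs
gcdList-∣ []       = []
gcdList-∣ (x ∷ xs) = gcd[m,n]∣m x (gcdList xs) ∷ All.map (∣-trans (gcd[m,n]∣n x (gcdList xs))) (gcdList-∣ xs)

τ : ℕ → ℕ
τ n = length (divisors n)

divisors-∣ : ∀ {d n} → d ∈ divisors n → d ∣ n
divisors-∣ {n = n} d∈ = proj₂ (∈-filter⁻ (_∣? n) {xs = map suc (upTo n)} d∈)

τ[n]≤n : ∀ n → τ n ≤ n
τ[n]≤n n = begin
  τ n                       ≤⟨ length-filter (_∣? n) (map suc (upTo n)) ⟩
  length (map suc (upTo n)) ≡⟨ length-map suc (upTo n) ⟩
  length (upTo n)           ≡⟨ length-upTo n ⟩
  n                         ∎
  where open ≤-Reasoning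

-- For n ≥ 3 the candidate n - 1 ≥ 2 is not a divisor of n.
τ[n]<n : ∀ {n} → 3 ≤ n → τ n < n
τ[n]<n {n@(suc n-1@(suc n-2))} (s≤s (s≤s (s≤s _))) = begin-strict
  τ n                       <⟨ filter-notAll (_∣? n) (map suc (upTo n)) (Any.map (λ { refl → n-1∤n }) n-1∈) ⟩
  length (map suc (upTo n)) ≡⟨ length-map suc (upTo n) ⟩
  length (upTo n)           ≡⟨ length-upTo n ⟩
  n                         ∎
  where
  open ≤-Reasoning
  n-1∤n : ¬ (n-1 ∣ n)
  n-1∤n n-1∣n with ∣1⇒≡1 (∣m+n∣m⇒∣n (subst (n-1 ∣_) (+-comm 1 n-1) n-1∣n) ∣-refl)
  ... | ()
  n-1∈ : n-1 ∈ map suc (upTo n)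
  n-1∈ = ∈-map⁺ suc (∈-upTo⁺ (s≤s (n≤1+n n-2)))

τ<⊎≡2 : ∀ {d n} → d ∣ n → 2 ≤ n → τ d < n ⊎ (d ≡ 2 × n ≡ 2)
τ<⊎≡2 {d} {n@(suc _)} d∣n 2≤n with m≤n⇒m<n∨m≡n (∣⇒≤ d∣n) | m≤n⇒m<n∨m≡n 2≤n
... | inj₁ d<n | _        = inj₁ (≤-<-trans (τ[n]≤n d) d<n)
... | inj₂ refl | inj₁ 2<n = inj₁ (τ[n]<n 2<n)
... | inj₂ refl | inj₂ refl = inj₂ (refl , refl)

sumℤ : List ℤ → ℤ
sumℤ = foldr ℤ._+_ 0ℤ

∣sumℤ∣≤length* : ∀ (f : ℕ → ℤ) ds {b} → (∀ {d} → d ∈ ds → ∣ f d ∣ ≤ b) → ∣ sumℤ (map f ds) ∣ ≤ length ds * b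
∣sumℤ∣≤length* f []       _     = z≤n
∣sumℤ∣≤length* f (d ∷ ds) f≤b = ≤-trans (ℤ.∣i+j∣≤∣i∣+∣j∣ (f d) (sumℤ (map f ds)))
  (+-mono-≤ (f≤b (here refl)) (∣sumℤ∣≤length* f ds (f≤b ∘ there)))

i≤+∣i∣ : ∀ i → i ℤ.≤ + ∣ i ∣
i≤+∣i∣ (+ n)    = ℤ.≤-refl
i≤+∣i∣ -[1+ n ] = ℤ.-≤+

∣i∣≤n⇒i≤+n : ∀ {i n} → ∣ i ∣ ≤ n → i ℤ.≤ + n
∣i∣≤n⇒i≤+n {i} ∣i∣≤n = ℤ.≤-trans (i≤+∣i∣ i) (+≤+ ∣i∣≤n)

∣i∣<n⇒i<+n : ∀ {i n} → ∣ i ∣ < n → i ℤ.< + n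
∣i∣<n⇒i<+n {i} ∣i∣<n = ℤ.≤-<-trans (i≤+∣i∣ i) (+<+ ∣i∣<n)

negOnePow≡±1 : ∀ n → negOnePow n ≡ 1ℤ ⊎ negOnePow n ≡ -1ℤ
negOnePow≡±1 zero = inj₁ refl
negOnePow≡±1 (suc n) with negOnePow≡±1 n
... | inj₁ s≡1  = inj₂ (cong (-1ℤ ℤ.*_) s≡1)
... | inj₂ s≡-1 = inj₁ (cong (-1ℤ ℤ.*_) s≡-1)

∣negOnePow∣≡1 : ∀ n → ∣ negOnePow n ∣ ≡ 1
∣negOnePow∣≡1 n with negOnePow≡±1 n
... | inj₁ s≡1  = cong ∣_∣ s≡1
... | inj₂ s≡-1 = cong ∣_∣ s≡-1

∣negOnePow*i∣≡∣i∣ : ∀ n i → ∣ negOnePow n ℤ.* i ∣ ≡ ∣ i ∣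
∣negOnePow*i∣≡∣i∣ n i = begin
  ∣ negOnePow n ℤ.* i ∣       ≡⟨ ℤ.∣i*j∣≡∣i∣*∣j∣ (negOnePow n) i ⟩
  ∣ negOnePow n ∣ * ∣ i ∣     ≡⟨ cong (_* ∣ i ∣) (∣negOnePow∣≡1 n) ⟩
  1 * ∣ i ∣                   ≡⟨ *-identityˡ ∣ i ∣ ⟩
  ∣ i ∣                       ∎
  where open ≡-Reasoning

negOnePow*negOnePow*i≡i : ∀ n i → negOnePow n ℤ.* (negOnePow n ℤ.* i) ≡ i
negOnePow*negOnePow*i≡i n i with negOnePow n | negOnePow≡±1 n
... | _ | inj₁ refl = trans (ℤ.*-identityˡ _) (ℤ.*-identityˡ i)
... | _ | inj₂ refl = trans (ℤ.-1*i≡-i _) (trans (cong ℤ.-_ (ℤ.-1*i≡-i i)) (ℤ.neg-involutive i))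

∣μ∣≤1 : ∀ n → ∣ μ n ∣ ≤ 1
∣μ∣≤1 zero = z≤n
∣μ∣≤1 (suc n) with squareFree (suc n)
... | true  = ≤-reflexive (∣negOnePow∣≡1 (numPrimeDivisors (suc n)))
... | false = z≤n

∣μ*negOnePow∣≤1 : ∀ n k → ∣ μ n ℤ.* negOnePow k ∣ ≤ 1
∣μ*negOnePow∣≤1 n k = begin
  ∣ μ n ℤ.* negOnePow k ∣   ≡⟨ cong ∣_∣ (ℤ.*-comm (μ n) (negOnePow k)) ⟩
  ∣ negOnePow k ℤ.* μ n ∣   ≡⟨ ∣negOnePow*i∣≡∣i∣ k (μ n) ⟩
  ∣ μ n ∣                   ≤⟨ ∣μ∣≤1 n ⟩
  1                         ∎
  where open ≤-Reasoning

-- The summands of Msum and Vsum, which Defs only defines locally.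
Mterm : List ℕ → ℕ → ℤ
Mterm xs zero        = 0ℤ
Mterm xs d@(suc _)   = μ d ℤ.* + multinomial (divAll d xs)

Vterm : ℕ → List ℕ → ℕ → ℤ
Vterm k xs zero      = 0ℤ
Vterm k xs d@(suc _) = μ d ℤ.* negOnePow (t k xs / d) ℤ.* + multinomial (divAll d xs)

signedVsum : ℕ → List ℕ → ℤ
signedVsum k xs = negOnePow (t k xs) ℤ.* Vsum k xs

Msum≡sumℤ[Mterm] : ∀ xs → Msum xs ≡ sumℤ (map (Mterm xs) (divisors (gcdList xs)))
Msum≡sumℤ[Mterm] xs = cong sumℤ (map-cong (λ { zero → refl ; (suc _) → refl }) (divisors (gcdList xs)))

Vsum≡sumℤ[Vterm] : ∀ k xs → Vsum k xs ≡ sumℤ (map (Vterm k xs) (divisors (gcdList xs)))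
Vsum≡sumℤ[Vterm] k xs = cong sumℤ (map-cong (λ { zero → refl ; (suc _) → refl }) (divisors (gcdList xs)))

∣i*+n∣≤n : ∀ i n → ∣ i ∣ ≤ 1 → ∣ i ℤ.* + n ∣ ≤ n
∣i*+n∣≤n i n ∣i∣≤1 = begin
  ∣ i ℤ.* + n ∣ ≡⟨ ℤ.∣i*j∣≡∣i∣*∣j∣ i (+ n) ⟩
  ∣ i ∣ * n     ≤⟨ *-monoˡ-≤ n ∣i∣≤1 ⟩
  1 * n         ≡⟨ *-identityˡ n ⟩
  n             ∎
  where open ≤-Reasoning

∣Mterm∣≤multinomial[divAll] : ∀ xs d .{{_ : NonZero d}} → ∣ Mterm xs d ∣ ≤ multinomial (divAll d xs)
∣Mterm∣≤multinomial[divAll] xs d@(suc _) = ∣i*+n∣≤n (μ d) _ (∣μ∣≤1 d)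

∣Vterm∣≤multinomial[divAll] : ∀ k xs d .{{_ : NonZero d}} → ∣ Vterm k xs d ∣ ≤ multinomial (divAll d xs)
∣Vterm∣≤multinomial[divAll] k xs d@(suc _) = ∣i*+n∣≤n (μ d ℤ.* negOnePow (t k xs / d)) _ (∣μ*negOnePow∣≤1 d (t k xs / d))

∣gcd⇒multinomial[divAll]≤multinomial : ∀ xs {d} .{{_ : NonZero d}} → d ∣ gcdList xs →
  multinomial (divAll d xs) ≤ multinomial xs
∣gcd⇒multinomial[divAll]≤multinomial xs {d} d∣g = multinomial[divAll]≤multinomial d (All.map (∣-trans d∣g) (gcdList-∣ xs))

∣Msum∣≤τ*multinomial : ∀ xs → ∣ Msum xs ∣ ≤ τ (gcdList xs) * multinomial xs
∣Msum∣≤τ*multinomial xs rewrite Msum≡sumℤ[Mterm] xs = ∣sumℤ∣≤length* (Mterm xs) (divisors (gcdList xs)) bound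
  where
  bound : ∀ {d} → d ∈ divisors (gcdList xs) → ∣ Mterm xs d ∣ ≤ multinomial xs
  bound {zero}  _  = z≤n
  bound {suc e} d∈ = ≤-trans (∣Mterm∣≤multinomial[divAll] xs (suc e))
                             (∣gcd⇒multinomial[divAll]≤multinomial xs (divisors-∣ d∈))

∣Vsum∣≤τ*multinomial : ∀ k xs → ∣ Vsum k xs ∣ ≤ τ (gcdList xs) * multinomial xs
∣Vsum∣≤τ*multinomial k xs rewrite Vsum≡sumℤ[Vterm] k xs = ∣sumℤ∣≤length* (Vterm k xs) (divisors (gcdList xs)) bound
  where
  bound : ∀ {d} → d ∈ divisors (gcdList xs) → ∣ Vterm k xs d ∣ ≤ multinomial xs
  bound {zero}  _  = z≤n
  bound {suc e} d∈ = ≤-trans (∣Vterm∣≤multinomial[divAll] k xs (suc e))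
                             (∣gcd⇒multinomial[divAll]≤multinomial xs (divisors-∣ d∈))

gcd≡1⇒Msum≡multinomial : ∀ xs → gcdList xs ≡ 1 → Msum xs ≡ + multinomial xs
gcd≡1⇒Msum≡multinomial xs g≡1 = begin
  Msum xs                                                ≡⟨ Msum≡sumℤ[Mterm] xs ⟩
  sumℤ (map (Mterm xs) (divisors (gcdList xs)))          ≡⟨ cong (λ g → sumℤ (map (Mterm xs) (divisors g))) g≡1 ⟩
  1ℤ ℤ.* + multinomial (divAll 1 xs) ℤ.+ 0ℤ              ≡⟨ ℤ.+-identityʳ _ ⟩
  1ℤ ℤ.* + multinomial (divAll 1 xs)                     ≡⟨ ℤ.*-identityˡ _ ⟩
  + multinomial (divAll 1 xs)                            ≡⟨ cong (+_ ∘ multinomial) (divAll-1 xs) ⟩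
  + multinomial xs                                       ∎
  where open ≡-Reasoning

gcd≡1⇒signedVsum≡multinomial : ∀ k xs → gcdList xs ≡ 1 → signedVsum k xs ≡ + multinomial xs
gcd≡1⇒signedVsum≡multinomial k xs g≡1 = begin
  s ℤ.* Vsum k xs                                          ≡⟨ cong (s ℤ.*_) (Vsum≡sumℤ[Vterm] k xs) ⟩
  s ℤ.* sumℤ (map (Vterm k xs) (divisors (gcdList xs)))    ≡⟨ cong (λ g → s ℤ.* sumℤ (map (Vterm k xs) (divisors g))) g≡1 ⟩
  s ℤ.* (1ℤ ℤ.* negOnePow (t k xs / 1) ℤ.* + W ℤ.+ 0ℤ)     ≡⟨ cong (s ℤ.*_) (ℤ.+-identityʳ (1ℤ ℤ.* negOnePow (t k xs / 1) ℤ.* + W)) ⟩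
  s ℤ.* (1ℤ ℤ.* negOnePow (t k xs / 1) ℤ.* + W)            ≡⟨ cong (λ i → s ℤ.* (i ℤ.* + W)) (ℤ.*-identityˡ (negOnePow (t k xs / 1))) ⟩
  s ℤ.* (negOnePow (t k xs / 1) ℤ.* + W)                   ≡⟨ cong (λ n → s ℤ.* (negOnePow n ℤ.* + W)) (n/1≡n (t k xs)) ⟩
  s ℤ.* (s ℤ.* + W)                                        ≡⟨ negOnePow*negOnePow*i≡i (t k xs) (+ W) ⟩
  + W                                                      ≡⟨ cong (+_ ∘ multinomial) (divAll-1 xs) ⟩
  + multinomial xs                                         ∎
  where
  open ≡-Reasoning
  s = negOnePow (t k xs)
  W = multinomial (divAll 1 xs)

gcd≡2⇒Msum≤multinomial : ∀ xs → gcdList xs ≡ 2 → Msum xs ℤ.≤ + multinomial xs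
gcd≡2⇒Msum≤multinomial xs g≡2 = begin
  Msum xs                                                 ≡⟨ Msum≡sumℤ[Mterm] xs ⟩
  sumℤ (map (Mterm xs) (divisors (gcdList xs)))           ≡⟨ cong (λ g → sumℤ (map (Mterm xs) (divisors g))) g≡2 ⟩
  1ℤ ℤ.* + W₁ ℤ.+ (-1ℤ ℤ.* + W₂ ℤ.+ 0ℤ)                   ≡⟨ cong₂ ℤ._+_ (ℤ.*-identityˡ (+ W₁)) (ℤ.+-identityʳ (-1ℤ ℤ.* + W₂)) ⟩
  + W₁ ℤ.+ -1ℤ ℤ.* + W₂                                   ≡⟨ cong (ℤ._+_ (+ W₁)) (ℤ.-1*i≡-i (+ W₂)) ⟩
  + W₁ ℤ.- + W₂                                           ≤⟨ ℤ.i-j≤i (+ W₁) (+ W₂) ⟩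
  + W₁                                                    ≡⟨ cong (+_ ∘ multinomial) (divAll-1 xs) ⟩
  + multinomial xs                                        ∎
  where
  open ℤ.≤-Reasoning
  W₁ = multinomial (divAll 1 xs)
  W₂ = multinomial (divAll 2 xs)

gcd≡2⇒∣Vsum∣≤multinomial+multinomial[divAll2] : ∀ k xs → gcdList xs ≡ 2 →
  ∣ Vsum k xs ∣ ≤ multinomial xs + multinomial (divAll 2 xs)
gcd≡2⇒∣Vsum∣≤multinomial+multinomial[divAll2] k xs g≡2 = begin
  ∣ Vsum k xs ∣                                           ≡⟨ cong ∣_∣ (Vsum≡sumℤ[Vterm] k xs) ⟩
  ∣ sumℤ (map (Vterm k xs) (divisors (gcdList xs))) ∣     ≡⟨ cong (λ g → ∣ sumℤ (map (Vterm k xs) (divisors g)) ∣) g≡2 ⟩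
  ∣ Vterm k xs 1 ℤ.+ (Vterm k xs 2 ℤ.+ 0ℤ) ∣              ≡⟨ cong (λ i → ∣ Vterm k xs 1 ℤ.+ i ∣) (ℤ.+-identityʳ _) ⟩
  ∣ Vterm k xs 1 ℤ.+ Vterm k xs 2 ∣                       ≤⟨ ℤ.∣i+j∣≤∣i∣+∣j∣ (Vterm k xs 1) (Vterm k xs 2) ⟩
  ∣ Vterm k xs 1 ∣ + ∣ Vterm k xs 2 ∣                     ≤⟨ +-mono-≤ (∣Vterm∣≤multinomial[divAll] k xs 1) (∣Vterm∣≤multinomial[divAll] k xs 2) ⟩
  multinomial (divAll 1 xs) + multinomial (divAll 2 xs)   ≡⟨ cong (λ ys → multinomial ys + multinomial (divAll 2 xs)) (divAll-1 xs) ⟩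
  multinomial xs + multinomial (divAll 2 xs)              ∎
  where open ≤-Reasoning

gcd[0∷1+m∷xs]∣1+m : ∀ m xs → gcdList (0 ∷ suc m ∷ xs) ∣ suc m
gcd[0∷1+m∷xs]∣1+m m xs with gcdList-∣ (0 ∷ suc m ∷ xs)
... | _ ∷ g∣1+m ∷ _ = g∣1+m

τ*multinomial[0∷1+m∷xs]≤multinomial[1∷m∷xs] : ∀ m xs →
  τ (gcdList (0 ∷ suc m ∷ xs)) * multinomial (0 ∷ suc m ∷ xs) ≤ multinomial (1 ∷ m ∷ xs)
τ*multinomial[0∷1+m∷xs]≤multinomial[1∷m∷xs] m xs = begin
  τ g * W₀    ≤⟨ *-monoˡ-≤ W₀ (≤-trans (τ[n]≤n g) (∣⇒≤ (gcd[0∷1+m∷xs]∣1+m m xs))) ⟩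
  suc m * W₀  ≡⟨ multinomial[1∷m∷xs]≡[1+m]*multinomial[0∷1+m∷xs] m xs ⟨
  multinomial (1 ∷ m ∷ xs) ∎
  where
  open ≤-Reasoning
  g  = gcdList (0 ∷ suc m ∷ xs)
  W₀ = multinomial (0 ∷ suc m ∷ xs)

τ*multinomial[0∷1+m∷xs]<multinomial[1∷m∷xs]⊎gcd≡2 : ∀ m xs → 1 ≤ m →
  τ (gcdList (0 ∷ suc m ∷ xs)) * multinomial (0 ∷ suc m ∷ xs) < multinomial (1 ∷ m ∷ xs)
  ⊎ (m ≡ 1 × gcdList (0 ∷ suc m ∷ xs) ≡ 2)
τ*multinomial[0∷1+m∷xs]<multinomial[1∷m∷xs]⊎gcd≡2 m xs 1≤m
  with τ<⊎≡2 (gcd[0∷1+m∷xs]∣1+m m xs) (s≤s 1≤m)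
... | inj₂ (g≡2 , 1+m≡2) = inj₂ (suc-injective 1+m≡2 , g≡2)
... | inj₁ τ<1+m         = inj₁ (begin-strict
  τ g * W₀    <⟨ *-monoˡ-< W₀ {{multinomial≢0 (0 ∷ suc m ∷ xs)}} τ<1+m ⟩
  suc m * W₀  ≡⟨ multinomial[1∷m∷xs]≡[1+m]*multinomial[0∷1+m∷xs] m xs ⟨
  multinomial (1 ∷ m ∷ xs) ∎)
  where
  open ≤-Reasoning
  g  = gcdList (0 ∷ suc m ∷ xs)
  W₀ = multinomial (0 ∷ suc m ∷ xs)

multinomial[0∷1+m∷xs]<multinomial[1∷m∷xs] : ∀ m xs → 1 ≤ m → multinomial (0 ∷ suc m ∷ xs) < multinomial (1 ∷ m ∷ xs)
multinomial[0∷1+m∷xs]<multinomial[1∷m∷xs] m xs 1≤m = begin-strict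
  W₀          <⟨ m<m*n W₀ (suc m) {{multinomial≢0 (0 ∷ suc m ∷ xs)}} (s≤s 1≤m) ⟩
  W₀ * suc m  ≡⟨ *-comm W₀ (suc m) ⟩
  suc m * W₀  ≡⟨ multinomial[1∷m∷xs]≡[1+m]*multinomial[0∷1+m∷xs] m xs ⟨
  multinomial (1 ∷ m ∷ xs) ∎
  where
  open ≤-Reasoning
  W₀ = multinomial (0 ∷ suc m ∷ xs)

Msum[0∷1+m∷xs]≤Msum[1∷m∷xs] : ∀ m xs → Msum (0 ∷ suc m ∷ xs) ℤ.≤ Msum (1 ∷ m ∷ xs)
Msum[0∷1+m∷xs]≤Msum[1∷m∷xs] m xs = begin
  Msum (0 ∷ suc m ∷ xs)        ≤⟨ ∣i∣≤n⇒i≤+n (≤-trans (∣Msum∣≤τ*multinomial (0 ∷ suc m ∷ xs))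
                                                      (τ*multinomial[0∷1+m∷xs]≤multinomial[1∷m∷xs] m xs)) ⟩
  + multinomial (1 ∷ m ∷ xs)   ≡⟨ gcd≡1⇒Msum≡multinomial (1 ∷ m ∷ xs) (gcd-zeroˡ (gcdList (m ∷ xs))) ⟨
  Msum (1 ∷ m ∷ xs)            ∎
  where open ℤ.≤-Reasoning

Msum[0∷1+m∷xs]<multinomial[1∷m∷xs] : ∀ m xs → 1 ≤ m → Msum (0 ∷ suc m ∷ xs) ℤ.< + multinomial (1 ∷ m ∷ xs)
Msum[0∷1+m∷xs]<multinomial[1∷m∷xs] m xs 1≤m with τ*multinomial[0∷1+m∷xs]<multinomial[1∷m∷xs]⊎gcd≡2 m xs 1≤m
... | inj₁ τ*W₀<W₁  = ∣i∣<n⇒i<+n (≤-<-trans (∣Msum∣≤τ*multinomial (0 ∷ suc m ∷ xs)) τ*W₀<W₁)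
... | inj₂ (_ , g≡2) = ℤ.≤-<-trans (gcd≡2⇒Msum≤multinomial (0 ∷ suc m ∷ xs) g≡2)
                                   (+<+ (multinomial[0∷1+m∷xs]<multinomial[1∷m∷xs] m xs 1≤m))

Msum[0∷1+m∷xs]<Msum[1∷m∷xs] : ∀ m xs → 1 ≤ m → Msum (0 ∷ suc m ∷ xs) ℤ.< Msum (1 ∷ m ∷ xs)
Msum[0∷1+m∷xs]<Msum[1∷m∷xs] m xs 1≤m = begin-strict
  Msum (0 ∷ suc m ∷ xs)        <⟨ Msum[0∷1+m∷xs]<multinomial[1∷m∷xs] m xs 1≤m ⟩
  + multinomial (1 ∷ m ∷ xs)   ≡⟨ gcd≡1⇒Msum≡multinomial (1 ∷ m ∷ xs) (gcd-zeroˡ (gcdList (m ∷ xs))) ⟨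
  Msum (1 ∷ m ∷ xs)            ∎
  where open ℤ.≤-Reasoning

∣Vsum[0∷2∷xs]∣<multinomial[1∷1∷xs] : ∀ k xs → gcdList (0 ∷ 2 ∷ xs) ≡ 2 → 1 ≤ sum xs →
  ∣ Vsum k (0 ∷ 2 ∷ xs) ∣ < multinomial (1 ∷ 1 ∷ xs)
∣Vsum[0∷2∷xs]∣<multinomial[1∷1∷xs] k xs g≡2 1≤sum = begin-strict
  ∣ Vsum k (0 ∷ 2 ∷ xs) ∣  ≤⟨ gcd≡2⇒∣Vsum∣≤multinomial+multinomial[divAll2] k (0 ∷ 2 ∷ xs) g≡2 ⟩
  W₀ + W₂                  <⟨ +-monoʳ-< W₀ (multinomial[divAll2]<multinomial 2∣xs 1≤sum) ⟩
  W₀ + W₀                  ≡⟨ cong (_+_ W₀) (+-identityʳ W₀) ⟨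
  2 * W₀                   ≡⟨ multinomial[1∷m∷xs]≡[1+m]*multinomial[0∷1+m∷xs] 1 xs ⟨
  multinomial (1 ∷ 1 ∷ xs) ∎
  where
  open ≤-Reasoning
  W₀ = multinomial (0 ∷ 2 ∷ xs)
  W₂ = multinomial (divAll 2 (0 ∷ 2 ∷ xs))
  2∣xs : All (2 ∣_) xs
  2∣xs with subst (λ g → All (g ∣_) (0 ∷ 2 ∷ xs)) g≡2 (gcdList-∣ (0 ∷ 2 ∷ xs))
  ... | _ ∷ _ ∷ 2∣xs = 2∣xs

∣signedVsum[0∷1+m∷xs]∣<multinomial[1∷m∷xs] : ∀ k m xs → 1 ≤ m → 3 ≤ suc m + sum xs →
  ∣ signedVsum k (0 ∷ suc m ∷ xs) ∣ < multinomial (1 ∷ m ∷ xs)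
∣signedVsum[0∷1+m∷xs]∣<multinomial[1∷m∷xs] k m xs 1≤m 3≤n
  rewrite ∣negOnePow*i∣≡∣i∣ (t k (0 ∷ suc m ∷ xs)) (Vsum k (0 ∷ suc m ∷ xs))
  with τ*multinomial[0∷1+m∷xs]<multinomial[1∷m∷xs]⊎gcd≡2 m xs 1≤m
... | inj₁ τ*W₀<W₁     = ≤-<-trans (∣Vsum∣≤τ*multinomial k (0 ∷ suc m ∷ xs)) τ*W₀<W₁
... | inj₂ (refl , g≡2) = ∣Vsum[0∷2∷xs]∣<multinomial[1∷1∷xs] k xs g≡2 (s≤s⁻¹ (s≤s⁻¹ 3≤n))

signedVsum[0∷1+m∷xs]≤signedVsum[1∷m∷xs] : ∀ k m xs → signedVsum k (0 ∷ suc m ∷ xs) ℤ.≤ signedVsum k (1 ∷ m ∷ xs)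
signedVsum[0∷1+m∷xs]≤signedVsum[1∷m∷xs] k m xs = begin
  signedVsum k (0 ∷ suc m ∷ xs)  ≤⟨ ∣i∣≤n⇒i≤+n ∣signedVsum∣≤W₁ ⟩
  + multinomial (1 ∷ m ∷ xs)     ≡⟨ gcd≡1⇒signedVsum≡multinomial k (1 ∷ m ∷ xs) (gcd-zeroˡ (gcdList (m ∷ xs))) ⟨
  signedVsum k (1 ∷ m ∷ xs)      ∎
  where
  open ℤ.≤-Reasoning
  ∣signedVsum∣≤W₁ : ∣ signedVsum k (0 ∷ suc m ∷ xs) ∣ ≤ multinomial (1 ∷ m ∷ xs)
  ∣signedVsum∣≤W₁ = ≤-trans (≤-reflexive (∣negOnePow*i∣≡∣i∣ (t k (0 ∷ suc m ∷ xs)) (Vsum k (0 ∷ suc m ∷ xs))))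
                    (≤-trans (∣Vsum∣≤τ*multinomial k (0 ∷ suc m ∷ xs)) (τ*multinomial[0∷1+m∷xs]≤multinomial[1∷m∷xs] m xs))

signedVsum[0∷1+m∷xs]<signedVsum[1∷m∷xs] : ∀ k m xs → 1 ≤ m → 3 ≤ suc m + sum xs →
  signedVsum k (0 ∷ suc m ∷ xs) ℤ.< signedVsum k (1 ∷ m ∷ xs)
signedVsum[0∷1+m∷xs]<signedVsum[1∷m∷xs] k m xs 1≤m 3≤n = begin-strict
  signedVsum k (0 ∷ suc m ∷ xs)  <⟨ ∣i∣<n⇒i<+n (∣signedVsum[0∷1+m∷xs]∣<multinomial[1∷m∷xs] k m xs 1≤m 3≤n) ⟩
  + multinomial (1 ∷ m ∷ xs)     ≡⟨ gcd≡1⇒signedVsum≡multinomial k (1 ∷ m ∷ xs) (gcd-zeroˡ (gcdList (m ∷ xs))) ⟨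
  signedVsum k (1 ∷ m ∷ xs)      ∎
  where open ℤ.≤-Reasoning

-- `i / suc m` is definitionally `fromℚᵘ (mkℚᵘ i m)`, so the comparison is transported from ℚᵘ.
/-monoˡ-≤ : ∀ {i j} m → i ℤ.≤ j → i ℚ./ suc m ℚ.≤ j ℚ./ suc m
/-monoˡ-≤ {i} {j} m i≤j = ℚ.toℚᵘ-cancel-≤
  (ℚᵘ.≤-respʳ-≃ (ℚᵘ.≃-sym (ℚ.toℚᵘ-fromℚᵘ (ℚᵘ.mkℚᵘ j m)))
    (ℚᵘ.≤-respˡ-≃ (ℚᵘ.≃-sym (ℚ.toℚᵘ-fromℚᵘ (ℚᵘ.mkℚᵘ i m)))
      (ℚᵘ.*≤* (ℤ.*-monoʳ-≤-nonNeg (+ suc m) i≤j))))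

/-monoˡ-< : ∀ {i j} m → i ℤ.< j → i ℚ./ suc m ℚ.< j ℚ./ suc m
/-monoˡ-< {i} {j} m i<j = ℚ.toℚᵘ-cancel-<
  (ℚᵘ.<-respʳ-≃ (ℚᵘ.≃-sym (ℚ.toℚᵘ-fromℚᵘ (ℚᵘ.mkℚᵘ j m)))
    (ℚᵘ.<-respˡ-≃ (ℚᵘ.≃-sym (ℚ.toℚᵘ-fromℚᵘ (ℚᵘ.mkℚᵘ i m)))
      (ℚᵘ.*<* (ℤ.*-monoʳ-<-pos (+ suc m) i<j))))

proposition3 : (n₂ : ℕ) (rest : List ℕ) →
    ((1 ≤ n₂ → M (0 ∷ n₂ ∷ rest) ℚ.≤ M (1 ∷ (n₂ ∸ 1) ∷ rest))
    × (2 ≤ n₂ → M (0 ∷ n₂ ∷ rest) ℚ.< M (1 ∷ (n₂ ∸ 1) ∷ rest)))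
    × ((k : ℕ) → 1 ≤ k → k ≤ 2 + length rest →
        (1 ≤ n₂ → V k (0 ∷ n₂ ∷ rest) ℚ.≤ V k (1 ∷ (n₂ ∸ 1) ∷ rest))
        × (2 ≤ n₂ → 3 ≤ n₂ + sum rest →
            V k (0 ∷ n₂ ∷ rest) ℚ.< V k (1 ∷ (n₂ ∸ 1) ∷ rest)))
proposition3 n₂ rest = (M-≤ n₂ , M-< n₂) , λ k _ _ → (V-≤ k n₂ , V-< k n₂)
  where
  M-≤ : ∀ n₂ → 1 ≤ n₂ → M (0 ∷ n₂ ∷ rest) ℚ.≤ M (1 ∷ (n₂ ∸ 1) ∷ rest)
  M-≤ (suc m) _ = /-monoˡ-≤ (m + sum rest) (Msum[0∷1+m∷xs]≤Msum[1∷m∷xs] m rest)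

  M-< : ∀ n₂ → 2 ≤ n₂ → M (0 ∷ n₂ ∷ rest) ℚ.< M (1 ∷ (n₂ ∸ 1) ∷ rest)
  M-< (suc m) (s≤s 1≤m) = /-monoˡ-< (m + sum rest) (Msum[0∷1+m∷xs]<Msum[1∷m∷xs] m rest 1≤m)

  V-≤ : ∀ k n₂ → 1 ≤ n₂ → V k (0 ∷ n₂ ∷ rest) ℚ.≤ V k (1 ∷ (n₂ ∸ 1) ∷ rest)
  V-≤ k (suc m) _ = /-monoˡ-≤ (m + sum rest) (signedVsum[0∷1+m∷xs]≤signedVsum[1∷m∷xs] k m rest)

  V-< : ∀ k n₂ → 2 ≤ n₂ → 3 ≤ n₂ + sum rest → V k (0 ∷ n₂ ∷ rest) ℚ.< V k (1 ∷ (n₂ ∸ 1) ∷ rest)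
  V-< k (suc m) (s≤s 1≤m) 3≤n = /-monoˡ-< (m + sum rest) (signedVsum[0∷1+m∷xs]<signedVsum[1∷m∷xs] k m rest 1≤m 3≤n)
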